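{- $\mathrm{DynQF}\subseteq\mathrm{DynCQ}$.
   Context: Dynamic complexity setting (relational version). A dynamic schema is a pair $(\tau_{in},\tau_{aux})$ of disjoint finite schemas; $\tau=\tau_{in}\cup\tau_{aux}$; $\tau_{in}$ is relational. A modification is $\mathrm{ins}_S(\vec a)$ or $\mathrm{del}_S(\vec a)$ for $S\in\tau_{in}$ and a tuple $\vec a$ of the arity of $S$. An update program assigns to every relation symbol $R\in\tau_{aux}$ and every $\delta\in\{\mathrm{ins}_S,\mathrm{del}_S : S\in\tau_{in}\}$ a formula $\phi^R_\delta(\vec u;\vec x)$ over $\tau$, $|\vec u|$ = arity of $S$, $|\vec x|$ = arity of $R$. A state is $(D,\mathcal I,\mathcal A)$ with finite domain $D$, an input database $\mathcal I$ and an auxiliary database $\mathcal A$ over $D$. Applying $\delta(\vec a)$ to a state $\mathcal S$ gives $(D,\delta(\mathcal I),\mathcal A')$ where $R^{\mathcal A'}=\{\vec b:\mathcal S\models\phi^R_\delta(\vec a;\vec b)\}$ (evaluated in the old state). A dynamic program is $(P,\mathrm{Init},Q)$ with $\mathrm{Init}$ an arbitrary mapping from input databases to auxiliary databases over the same domain and $Q\in\tau_{aux}$ a relation symbol. It maintains a query $\mathcal Q$ if for every input database $\mathcal D$ with domain $D$ and every finite modification sequence $\alpha$, $\mathcal Q(\alpha(\mathcal D))$ equals the interpretation of $Q$ in the state obtained from $(D,\mathcal D,\mathrm{Init}(\mathcal D))$ by applying $\alpha$. DynCQ is the class of queries maintained by dynamic programs with relational $\tau_{aux}$ all of whose update formulas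 are conjunctive queries $\exists\vec y\,\psi$ with $\psi$ a conjunction of atoms. DynQF: here $\tau_{aux}$ may additionally contain function symbols, interpreted by total functions on $D$. Update terms are defined inductively: every variable is an update term; if $f$ is a $k$-ary function symbol and $t_1,\dots,t_k$ are update terms then $f(t_1,\dots,t_k)$ is one; if $\phi$ is a quantifier-free formula (whose terms are update terms) and $t_1,t_2$ are update terms then $\mathrm{ite}(\phi,t_1,t_2)$ is one, with value that of $t_1$ if $\phi$ holds and that of $t_2$ otherwise. A DynQF update program has, for every auxiliary relation symbol $R$ and $\delta$, a quantifier-free update formula $\phi^R_\delta(\vec u;\vec x)$ whose terms are update terms, and for every auxiliary function symbol $f$ and $\delta$, an update term $t^f_\delta(\vec u;\vec x)$; upon $\delta(\vec a)$, $f$ is redefined by $f(\vec b):=$ value of $t^f_\delta(\vec a;\vec b)$ in the old state. DynQF is the class of queries maintained by such programs (with arbitrary initialization and relational query symbol $Q$). -}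

module Defs where

open import Data.Nat using (ℕ; zero; suc; _+_)
open import Data.Fin using (Fin; zero; suc) renaming (_≟_ to _≟F_)
open import Data.Vec using (Vec; []; _∷_; _++_; lookup; cast) renaming (map to vmap)
open import Data.Vec.Properties using (≡-dec)
open import Data.List using (List; foldl; foldr; map)
open import Data.Product using (Σ)
open import Data.Bool using (Bool; true; false; _∨_; _∧_; not; if_then_else_)
open import Data.Sum using (_⊎_; inj₁; inj₂)
open import Relation.Nullary using (yes; no)
open import Relation.Nullary.Decidable using (⌊_⌋)
open import Relation.Binary.PropositionalEquality using (_≡_; refl)

Rel : ℕ → ℕ → Set
Rel N k = Vec (Fin N) k → Bool

_≟V_ : ∀ {N k} → (a b : Vec (Fin N) k) → _
_≟V_ = ≡-dec _≟F_

anyFin : ∀ {N} → (Fin N → Bool) → Bool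
anyFin {zero}  P = false
anyFin {suc N} P = P zero ∨ anyFin (λ i → P (suc i))

existsTuple : ∀ {N} (e : ℕ) → (Vec (Fin N) e → Bool) → Bool
existsTuple zero    P = P []
existsTuple (suc e) P = anyFin (λ a → existsTuple e (λ v → P (a ∷ v)))

record InSchema : Set where
  field
    nIn  : ℕ
    arIn : Fin nIn → ℕ
open InSchema public

InDB : InSchema → ℕ → Set
InDB σ N = (S : Fin (nIn σ)) → Rel N (arIn σ S)

data Kind : Set where
  ins del : Kind

record Mod (σ : InSchema) (N : ℕ) : Set where
  constructor mod
  field
    kind : Kind
    sym  : Fin (nIn σ)
    tup  : Vec (Fin N) (arIn σ sym)
open Mod public

updRel : ∀ {N k} → Kind → Vec (Fin N) k → Rel N k → Rel N k
updRel ins a R b = R b ∨ ⌊ b ≟V a ⌋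
updRel del a R b = R b ∧ not ⌊ b ≟V a ⌋

applyMod : ∀ {σ N} → Mod σ N → InDB σ N → InDB σ N
applyMod (mod k S a) I S' with S' ≟F S
... | yes refl = updRel k a (I S')
... | no _     = I S'

applySeq : ∀ {σ N} → List (Mod σ N) → InDB σ N → InDB σ N
applySeq α I = foldl (λ J δ → applyMod δ J) I α

record Query (σ : InSchema) : Set where
  field
    qArity : ℕ
    answer : (n : ℕ) → InDB σ (suc n) → Rel (suc n) qArity
open Query public

record CQAuxSchema : Set where
  field
    nAux  : ℕ
    arAux : Fin nAux → ℕ
open CQAuxSchema public

arCQ : (σ : InSchema) (ρ : CQAuxSchema) → Fin (nIn σ) ⊎ Fin (nAux ρ) → ℕ
arCQ σ ρ (inj₁ S) = arIn σ S
arCQ σ ρ (inj₂ R) = arAux ρ R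

data CQAtom (σ : InSchema) (ρ : CQAuxSchema) (m : ℕ) : Set where
  rel : (R : Fin (nIn σ) ⊎ Fin (nAux ρ)) → Vec (Fin m) (arCQ σ ρ R) → CQAtom σ ρ m
  eq  : Fin m → Fin m → CQAtom σ ρ m

-- ∃ y₁ … yₑ (a₁ ∧ … ∧ aₗ); free variables Fin m, then the bound ones
record CQ (σ : InSchema) (ρ : CQAuxSchema) (m : ℕ) : Set where
  constructor cq
  field
    nEx   : ℕ
    atoms : List (CQAtom σ ρ (m + nEx))

CQAuxDB : CQAuxSchema → ℕ → Set
CQAuxDB ρ N = (R : Fin (nAux ρ)) → Rel N (arAux ρ R)

record CQState (σ : InSchema) (ρ : CQAuxSchema) (N : ℕ) : Set where
  constructor st
  field
    inDB  : InDB σ N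
    auxDB : CQAuxDB ρ N
open CQState public

relCQ : ∀ {σ ρ N} → CQState σ ρ N → (R : Fin (nIn σ) ⊎ Fin (nAux ρ)) → Rel N (arCQ σ ρ R)
relCQ s (inj₁ S) = inDB s S
relCQ s (inj₂ R) = auxDB s R

evalAtom : ∀ {σ ρ N m} → CQState σ ρ N → Vec (Fin N) m → CQAtom σ ρ m → Bool
evalAtom s env (rel R vs) = relCQ s R (vmap (lookup env) vs)
evalAtom s env (eq i j)   = ⌊ lookup env i ≟F lookup env j ⌋

evalCQ : ∀ {σ ρ N m} → CQState σ ρ N → Vec (Fin N) m → CQ σ ρ m → Bool
evalCQ s env (cq e as) = existsTuple e (λ y → foldr _∧_ true (map (evalAtom s (env ++ y)) as))

record CQProgram (σ : InSchema) : Set where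
  field
    auxSch : CQAuxSchema
    -- φ^R_δ(u⃗ ; x⃗) for δ = kind_S : variables u⃗ first, then x⃗
    update : (k : Kind) (S : Fin (nIn σ)) (R : Fin (nAux auxSch)) →
             CQ σ auxSch (arIn σ S + arAux auxSch R)
    init   : (n : ℕ) → InDB σ (suc n) → CQAuxDB auxSch (suc n)
    qSym   : Fin (nAux auxSch)
open CQProgram public

stepCQ : ∀ {σ N} (P : CQProgram σ) → CQState σ (auxSch P) N → Mod σ N →
         CQState σ (auxSch P) N
stepCQ P s (mod k S a) =
  st (applyMod (mod k S a) (inDB s))
     (λ R b → evalCQ s (a ++ b) (update P k S R))

runCQ : ∀ {σ N} (P : CQProgram σ) → CQState σ (auxSch P) N → List (Mod σ N) →
        CQState σ (auxSch P) N
runCQ P s α = foldl (stepCQ P) s α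

MaintainsCQ : ∀ {σ} → CQProgram σ → Query σ → Set
MaintainsCQ {σ} P 𝒬 =
  Σ (arAux (auxSch P) (qSym P) ≡ qArity 𝒬) λ e →
    (n : ℕ) (I : InDB σ (suc n)) (α : List (Mod σ (suc n)))
    (b : Vec (Fin (suc n)) (arAux (auxSch P) (qSym P))) →
    auxDB (runCQ P (st I (init P n I)) α) (qSym P) b
      ≡ answer 𝒬 n (applySeq α I) (cast e b)

record QFAuxSchema : Set where
  field
    nRel  : ℕ
    arRel : Fin nRel → ℕ
    nFun  : ℕ
    arFun : Fin nFun → ℕ
open QFAuxSchema public

arQF : (σ : InSchema) (ρ : QFAuxSchema) → Fin (nIn σ) ⊎ Fin (nRel ρ) → ℕ
arQF σ ρ (inj₁ S) = arIn σ S
arQF σ ρ (inj₂ R) = arRel ρ R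

module QFSyntax (σ : InSchema) (ρ : QFAuxSchema) where
  mutual
    data Term (m : ℕ) : Set where
      var : Fin m → Term m
      app : (f : Fin (nFun ρ)) → Vec (Term m) (arFun ρ f) → Term m
      ite : Formula m → Term m → Term m → Term m

    data Formula (m : ℕ) : Set where
      rel  : (R : Fin (nIn σ) ⊎ Fin (nRel ρ)) → Vec (Term m) (arQF σ ρ R) → Formula m
      eq   : Term m → Term m → Formula m
      neg  : Formula m → Formula m
      conj : Formula m → Formula m → Formula m
      disj : Formula m → Formula m → Formula m

open QFSyntax public

record QFAuxDB (ρ : QFAuxSchema) (N : ℕ) : Set where
  constructor aux
  field
    relA : (R : Fin (nRel ρ)) → Rel N (arRel ρ R)
    funA : (f : Fin (nFun ρ)) → Vec (Fin N) (arFun ρ f) → Fin N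
open QFAuxDB public

record QFState (σ : InSchema) (ρ : QFAuxSchema) (N : ℕ) : Set where
  constructor qst
  field
    qInDB  : InDB σ N
    qAuxDB : QFAuxDB ρ N
open QFState public

relQF : ∀ {σ ρ N} → QFState σ ρ N → (R : Fin (nIn σ) ⊎ Fin (nRel ρ)) → Rel N (arQF σ ρ R)
relQF s (inj₁ S) = qInDB s S
relQF s (inj₂ R) = relA (qAuxDB s) R

module _ {σ : InSchema} {ρ : QFAuxSchema} {N : ℕ} (s : QFState σ ρ N) where
  mutual
    evalT : ∀ {m} → Vec (Fin N) m → Term σ ρ m → Fin N
    evalT env (var x)     = lookup env x
    evalT env (app f ts)  = funA (qAuxDB s) f (evalTs env ts)
    evalT env (ite φ t u) = if evalF env φ then evalT env t else evalT env u

    evalTs : ∀ {m k} → Vec (Fin N) m → Vec (Term σ ρ m) k → Vec (Fin N) k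
    evalTs env []       = []
    evalTs env (t ∷ ts) = evalT env t ∷ evalTs env ts

    evalF : ∀ {m} → Vec (Fin N) m → Formula σ ρ m → Bool
    evalF env (rel R ts)  = relQF s R (evalTs env ts)
    evalF env (eq t u)    = ⌊ evalT env t ≟F evalT env u ⌋
    evalF env (neg φ)     = not (evalF env φ)
    evalF env (conj φ ψ)  = evalF env φ ∧ evalF env ψ
    evalF env (disj φ ψ)  = evalF env φ ∨ evalF env ψ

record QFProgram (σ : InSchema) : Set where
  field
    qfAuxSch  : QFAuxSchema
    -- φ^R_δ(u⃗ ; x⃗) and t^f_δ(u⃗ ; x⃗) for δ = kind_S : variables u⃗ first, then x⃗
    updateRel : (k : Kind) (S : Fin (nIn σ)) (R : Fin (nRel qfAuxSch)) →
                Formula σ qfAuxSch (arIn σ S + arRel qfAuxSch R)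
    updateFun : (k : Kind) (S : Fin (nIn σ)) (f : Fin (nFun qfAuxSch)) →
                Term σ qfAuxSch (arIn σ S + arFun qfAuxSch f)
    qfInit    : (n : ℕ) → InDB σ (suc n) → QFAuxDB qfAuxSch (suc n)
    qfQSym    : Fin (nRel qfAuxSch)
open QFProgram public

stepQF : ∀ {σ N} (P : QFProgram σ) → QFState σ (qfAuxSch P) N → Mod σ N →
         QFState σ (qfAuxSch P) N
stepQF P s (mod k S a) =
  qst (applyMod (mod k S a) (qInDB s))
      (aux (λ R b → evalF s (a ++ b) (updateRel P k S R))
           (λ f b → evalT s (a ++ b) (updateFun P k S f)))

runQF : ∀ {σ N} (P : QFProgram σ) → QFState σ (qfAuxSch P) N → List (Mod σ N) →
        QFState σ (qfAuxSch P) N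
runQF P s α = foldl (stepQF P) s α

MaintainsQF : ∀ {σ} → QFProgram σ → Query σ → Set
MaintainsQF {σ} P 𝒬 =
  Σ (arRel (qfAuxSch P) (qfQSym P) ≡ qArity 𝒬) λ e →
    (n : ℕ) (I : InDB σ (suc n)) (α : List (Mod σ (suc n)))
    (b : Vec (Fin (suc n)) (arRel (qfAuxSch P) (qfQSym P))) →
    relA (qAuxDB (runQF P (qst I (qfInit P n I)) α)) (qfQSym P) b
      ≡ answer 𝒬 n (applySeq α I) (cast e b)

DynCQ : (σ : InSchema) → Query σ → Set
DynCQ σ 𝒬 = Σ (CQProgram σ) λ P → MaintainsCQ P 𝒬

DynQF : (σ : InSchema) → Query σ → Set
DynQF σ 𝒬 = Σ (QFProgram σ) λ P → MaintainsQF P 𝒬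

-- Encode the truth values by the domain elements ⌜ false ⌝ = 0 and ⌜ true ⌝ = 1 and let the CQ
-- program maintain the graphs of all auxiliary functions, of the characteristic functions of all
-- input and auxiliary relations, and of the fixed operations =, if-then-else and the two truth
-- constants.  A quantifier-free update term or formula then becomes a term t over these operations,
-- and "y = t(x⃗)" is a conjunctive query: guess the values of all subterms existentially and check
-- each guess against the graph of its head operation.  The guesses are forced.  The query relation is maintained as ∃ v (v = ⌜ φ ⌝ ∧ v = ⌜ true ⌝)
-- for its update formula φ.
-- On the one-element domain the two truth values coincide.  There a state is determined by the bits
-- of its relations at the unique tuple, and an update acts on these codes by a fixed map F; so for
-- every Boolean function g of the code a 0-ary relation records g(code), updated by copying the one
-- recorded for g ∘ F.

module Submission where

open import Defs
open import Data.Nat using (ℕ; zero; suc; _+_; _^_)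
open import Data.Fin using (Fin; zero; suc; _↑ˡ_; _↑ʳ_; splitAt; join; combine; funToFin; finToFun) renaming (_≟_ to _≟F_)
open import Data.Vec using (Vec; []; _∷_; _++_; lookup; tabulate; replicate; cast) renaming (map to vmap)
open import Data.Vec.Properties using (lookup-++ˡ; lookup-++ʳ; lookup-splitAt; map-∘; map-cong; tabulate-cong; tabulate∘lookup; tabulate-∘)
open import Data.Fin.Properties using (splitAt-↑ˡ; splitAt-↑ʳ; splitAt-join; finToFun-funToFin)
open import Data.Vec.Functional using () renaming (_++_ to _⊕_; _∷_ to _◂_)
open import Data.List using (List; []; _∷_; foldr) renaming (map to lmap; _++_ to _++ₗ_)
open import Data.Bool using (Bool; true; false; _∨_; _∧_; not; if_then_else_)
open import Data.Bool.Properties using (∧-assoc; ∧-zeroʳ; ∧-identityʳ; ∨-identityʳ)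
open import Data.Product using (_,_)
open import Data.Sum using (_⊎_; inj₁; inj₂; [_,_])
open import Data.Sum.Properties using ([,]-∘; [,]-cong)
open import Function using (_∘_)
open import Relation.Nullary using (yes; no)
open import Relation.Nullary.Decidable using (⌊_⌋; does; isYes≗does; ⌊⌋-map′)
open import Relation.Binary.PropositionalEquality as ≡ using (_≡_; _≗_; refl; trans; cong; cong₂)
open ≡.≡-Reasoning

anyFin-cong : ∀ {N} {P Q : Fin N → Bool} → P ≗ Q → anyFin P ≡ anyFin Q
anyFin-cong {zero}  h = refl
anyFin-cong {suc N} h = cong₂ _∨_ (h zero) (anyFin-cong (h ∘ suc))

anyFin-false : ∀ N → anyFin {N} (λ _ → false) ≡ false
anyFin-false zero    = refl
anyFin-false (suc N) = anyFin-false N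

anyFin-onePoint : ∀ {N} (w : Fin N) (P : Fin N → Bool) → anyFin (λ a → ⌊ a ≟F w ⌋ ∧ P a) ≡ P w
anyFin-onePoint {suc N} zero    P = trans (cong (P zero ∨_) (anyFin-false N)) (∨-identityʳ (P zero))
anyFin-onePoint {suc N} (suc w) P =
  trans (anyFin-cong (λ a → cong (_∧ P (suc a)) (⌊⌋-map′ _ _ (a ≟F w)))) (anyFin-onePoint w (P ∘ suc))

existsTuple-cong : ∀ {N} e {P Q : Vec (Fin N) e → Bool} → P ≗ Q → existsTuple e P ≡ existsTuple e Q
existsTuple-cong zero    h = h []
existsTuple-cong (suc e) h = anyFin-cong (λ a → existsTuple-cong e (h ∘ (a ∷_)))

existsTuple-false : ∀ {N} e → existsTuple {N} e (λ _ → false) ≡ false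
existsTuple-false {N} zero    = refl
existsTuple-false {N} (suc e) = trans (anyFin-cong {N} (λ _ → existsTuple-false e)) (anyFin-false N)

existsTuple-∧ˡ : ∀ {N} e b (P : Vec (Fin N) e → Bool) →
                 existsTuple e (λ v → b ∧ P v) ≡ b ∧ existsTuple e P
existsTuple-∧ˡ e true  P = refl
existsTuple-∧ˡ e false P = existsTuple-false e

existsTuple-∧ʳ : ∀ {N} e b (P : Vec (Fin N) e → Bool) →
                 existsTuple e (λ v → P v ∧ b) ≡ existsTuple e P ∧ b
existsTuple-∧ʳ e true  P = trans (existsTuple-cong e (∧-identityʳ ∘ P)) (≡.sym (∧-identityʳ _))
existsTuple-∧ʳ e false P =
  trans (existsTuple-cong e (∧-zeroʳ ∘ P)) (trans (existsTuple-false e) (≡.sym (∧-zeroʳ _)))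

existsTuple-+ : ∀ {N} e₁ e₂ (P : Vec (Fin N) (e₁ + e₂) → Bool) →
  existsTuple (e₁ + e₂) P ≡ existsTuple e₁ (λ y₁ → existsTuple e₂ (λ y₂ → P (y₁ ++ y₂)))
existsTuple-+ zero     e₂ P = refl
existsTuple-+ (suc e₁) e₂ P = anyFin-cong (λ a → existsTuple-+ e₁ e₂ (P ∘ (a ∷_)))

⌊∷≟∷⌋ : ∀ {N k} (u w : Fin N) (us ws : Vec (Fin N) k) →
        ⌊ (u ∷ us) ≟V (w ∷ ws) ⌋ ≡ ⌊ u ≟F w ⌋ ∧ ⌊ us ≟V ws ⌋
⌊∷≟∷⌋ u w us ws = begin
  ⌊ (u ∷ us) ≟V (w ∷ ws) ⌋          ≡⟨ isYes≗does ((u ∷ us) ≟V (w ∷ ws)) ⟩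
  does (u ≟F w) ∧ does (us ≟V ws)  ≡⟨ cong₂ _∧_ (isYes≗does (u ≟F w)) (isYes≗does (us ≟V ws)) ⟨
  ⌊ u ≟F w ⌋ ∧ ⌊ us ≟V ws ⌋          ∎

existsTuple-onePoint : ∀ {N} k (ws : Vec (Fin N) k) (P : Vec (Fin N) k → Bool) →
                       existsTuple k (λ zs → ⌊ zs ≟V ws ⌋ ∧ P zs) ≡ P ws
existsTuple-onePoint zero    []       P = refl
existsTuple-onePoint (suc k) (w ∷ ws) P = begin
  anyFin (λ a → existsTuple k (λ zs → ⌊ (a ∷ zs) ≟V (w ∷ ws) ⌋ ∧ P (a ∷ zs)))
    ≡⟨ anyFin-cong (λ a → existsTuple-cong k (λ zs →
         trans (cong (_∧ P (a ∷ zs)) (⌊∷≟∷⌋ a w zs ws)) (∧-assoc ⌊ a ≟F w ⌋ _ _))) ⟩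
  anyFin (λ a → existsTuple k (λ zs → ⌊ a ≟F w ⌋ ∧ (⌊ zs ≟V ws ⌋ ∧ P (a ∷ zs))))
    ≡⟨ anyFin-cong (λ a → existsTuple-∧ˡ k ⌊ a ≟F w ⌋ _) ⟩
  anyFin (λ a → ⌊ a ≟F w ⌋ ∧ existsTuple k (λ zs → ⌊ zs ≟V ws ⌋ ∧ P (a ∷ zs)))
    ≡⟨ anyFin-onePoint w _ ⟩
  existsTuple k (λ zs → ⌊ zs ≟V ws ⌋ ∧ P (w ∷ zs))
    ≡⟨ existsTuple-onePoint k ws (P ∘ (w ∷_)) ⟩
  P (w ∷ ws) ∎

record Reindexes {A : Set} {m m'} (f : Fin m → Fin m') (xs : Vec A m) (ys : Vec A m') : Set where
  constructor reindexes
  field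
    agrees : lookup ys ∘ f ≗ lookup xs
open Reindexes

module _ {A : Set} where

  ↑ˡ-reindexes : ∀ {m n} (xs : Vec A m) (ys : Vec A n) → Reindexes (_↑ˡ n) xs (xs ++ ys)
  ↑ˡ-reindexes xs ys = reindexes (lookup-++ˡ xs ys)

  ↑ʳ-reindexes : ∀ {m n} (xs : Vec A m) (ys : Vec A n) → Reindexes (m ↑ʳ_) ys (xs ++ ys)
  ↑ʳ-reindexes xs ys = reindexes (lookup-++ʳ xs ys)

  ∘-reindexes : ∀ {l m n} {f : Fin l → Fin m} {g : Fin m → Fin n} {xs ys zs} →
                Reindexes g ys zs → Reindexes f xs ys → Reindexes {A} (g ∘ f) xs zs
  ∘-reindexes {f = f} hg hf = reindexes (λ i → trans (agrees hg (f i)) (agrees hf i))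

  ⊕-reindexes : ∀ {l m n} {f : Fin l → Fin n} {g : Fin m → Fin n} {xs ys} {zs : Vec A n} →
                Reindexes f xs zs → Reindexes g ys zs → Reindexes (f ⊕ g) (xs ++ ys) zs
  ⊕-reindexes {l} {f = f} {g} {xs} {ys} {zs} hf hg = reindexes λ i → begin
    lookup zs ([ f , g ] (splitAt l i))              ≡⟨ [,]-∘ (lookup zs) (splitAt l i) ⟩
    [ lookup zs ∘ f , lookup zs ∘ g ] (splitAt l i)  ≡⟨ [,]-cong (agrees hf) (agrees hg) (splitAt l i) ⟩
    [ lookup xs , lookup ys ] (splitAt l i)          ≡⟨ lookup-splitAt l xs ys i ⟨
    lookup (xs ++ ys) i                              ∎

  ◂-reindexes : ∀ {m n} {i : Fin n} {f : Fin m → Fin n} {x xs} {ys : Vec A n} →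
                lookup ys i ≡ x → Reindexes f xs ys → Reindexes (i ◂ f) (x ∷ xs) ys
  ◂-reindexes hi hf = reindexes λ where
    zero    → hi
    (suc j) → agrees hf j

  tabulate-reindexes : ∀ {m n} {f : Fin m → Fin n} {xs} {ys : Vec A n} →
                       Reindexes f xs ys → tabulate (lookup ys ∘ f) ≡ xs
  tabulate-reindexes {xs = xs} h = trans (tabulate-cong (agrees h)) (tabulate∘lookup xs)

-- Conjunctive formulas with nested quantifiers, and their prenex form

module ConjunctiveFormulas (σ : InSchema) (ρ : CQAuxSchema) where

  renameAtom : ∀ {m m'} → (Fin m → Fin m') → CQAtom σ ρ m → CQAtom σ ρ m'
  renameAtom f (rel R vs) = rel R (vmap f vs)
  renameAtom f (eq i j)   = eq (f i) (f j)

  holdsAll : ∀ {N m} → CQState σ ρ N → Vec (Fin N) m → List (CQAtom σ ρ m) → Bool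
  holdsAll s env as = foldr _∧_ true (lmap (evalAtom s env) as)

  data ConjFormula (m : ℕ) : Set where
    atom  : CQAtom σ ρ m → ConjFormula m
    ⊤ᶜ    : ConjFormula m
    _∧ᶜ_  : ConjFormula m → ConjFormula m → ConjFormula m
    ∃ᶜ    : (k : ℕ) → ConjFormula (k + m) → ConjFormula m

  holds : ∀ {N m} → CQState σ ρ N → Vec (Fin N) m → ConjFormula m → Bool
  holds s env (atom a)  = evalAtom s env a
  holds s env ⊤ᶜ        = true
  holds s env (φ ∧ᶜ ψ)  = holds s env φ ∧ holds s env ψ
  holds s env (∃ᶜ k φ)  = existsTuple k (λ zs → holds s (zs ++ env) φ)

  liftRenaming : ∀ {m m'} k → (Fin m → Fin m') → Fin (k + m) → Fin (k + m')
  liftRenaming {m' = m'} k f = (_↑ˡ m') ⊕ ((k ↑ʳ_) ∘ f)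

  renameᶜ : ∀ {m m'} → (Fin m → Fin m') → ConjFormula m → ConjFormula m'
  renameᶜ f (atom a) = atom (renameAtom f a)
  renameᶜ f ⊤ᶜ       = ⊤ᶜ
  renameᶜ f (φ ∧ᶜ ψ) = renameᶜ f φ ∧ᶜ renameᶜ f ψ
  renameᶜ f (∃ᶜ k φ) = ∃ᶜ k (renameᶜ (liftRenaming k f) φ)

  atomCQ : ∀ {m} → CQAtom σ ρ m → CQ σ ρ m
  atomCQ a = cq 0 (renameAtom (_↑ˡ 0) a ∷ [])

  conjunctˡ : ∀ {m} e₁ e₂ → Fin (m + e₁) → Fin (m + (e₁ + e₂))
  conjunctˡ {m} e₁ e₂ = (λ (i : Fin m) → i ↑ˡ (e₁ + e₂)) ⊕ ((m ↑ʳ_) ∘ (_↑ˡ e₂))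

  conjunctʳ : ∀ {m} e₁ e₂ → Fin (m + e₂) → Fin (m + (e₁ + e₂))
  conjunctʳ {m} e₁ e₂ = (λ (i : Fin m) → i ↑ˡ (e₁ + e₂)) ⊕ ((m ↑ʳ_) ∘ (e₁ ↑ʳ_))

  conjCQ : ∀ {m} → CQ σ ρ m → CQ σ ρ m → CQ σ ρ m
  conjCQ (cq e₁ as₁) (cq e₂ as₂) =
    cq (e₁ + e₂) (lmap (renameAtom (conjunctˡ e₁ e₂)) as₁ ++ₗ lmap (renameAtom (conjunctʳ e₁ e₂)) as₂)

  existsCQ : ∀ {m} k → CQ σ ρ (k + m) → CQ σ ρ m
  existsCQ {m} k (cq e as) = cq (k + e) (lmap (renameAtom shuffle) as)
    where
    shuffle : Fin ((k + m) + e) → Fin (m + (k + e))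
    shuffle = ((λ (z : Fin k) → m ↑ʳ (z ↑ˡ e)) ⊕ (_↑ˡ (k + e))) ⊕ ((m ↑ʳ_) ∘ (k ↑ʳ_))

  toCQ : ∀ {m} → ConjFormula m → CQ σ ρ m
  toCQ (atom a) = atomCQ a
  toCQ ⊤ᶜ       = cq 0 []
  toCQ (φ ∧ᶜ ψ) = conjCQ (toCQ φ) (toCQ ψ)
  toCQ (∃ᶜ k φ) = existsCQ k (toCQ φ)

  module _ {N} (s : CQState σ ρ N) where

    evalAtom-rename : ∀ {m m'} {f : Fin m → Fin m'} {env env'} → Reindexes f env env' →
                      ∀ a → evalAtom s env' (renameAtom f a) ≡ evalAtom s env a
    evalAtom-rename {f = f} {env' = env'} h (rel R vs) =
      cong (relCQ s R) (trans (≡.sym (map-∘ (lookup env') f vs)) (map-cong (agrees h) vs))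
    evalAtom-rename h (eq i j) = cong₂ (λ x y → ⌊ x ≟F y ⌋) (agrees h i) (agrees h j)

    holdsAll-rename : ∀ {m m'} {f : Fin m → Fin m'} {env env'} → Reindexes f env env' →
                      ∀ as → holdsAll s env' (lmap (renameAtom f) as) ≡ holdsAll s env as
    holdsAll-rename h []       = refl
    holdsAll-rename h (a ∷ as) = cong₂ _∧_ (evalAtom-rename h a) (holdsAll-rename h as)

    holdsAll-++ : ∀ {m} (env : Vec (Fin N) m) as bs →
                  holdsAll s env (as ++ₗ bs) ≡ holdsAll s env as ∧ holdsAll s env bs
    holdsAll-++ env []       bs = refl
    holdsAll-++ env (a ∷ as) bs =
      trans (cong (evalAtom s env a ∧_) (holdsAll-++ env as bs)) (≡.sym (∧-assoc (evalAtom s env a) _ _))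

    holds-rename : ∀ {m m'} {f : Fin m → Fin m'} {env env'} → Reindexes f env env' →
                   ∀ φ → holds s env' (renameᶜ f φ) ≡ holds s env φ
    holds-rename h (atom a) = evalAtom-rename h a
    holds-rename h ⊤ᶜ       = refl
    holds-rename h (φ ∧ᶜ ψ) = cong₂ _∧_ (holds-rename h φ) (holds-rename h ψ)
    holds-rename {env' = env'} h (∃ᶜ k φ) = existsTuple-cong k (λ zs →
      holds-rename (⊕-reindexes (↑ˡ-reindexes zs env') (∘-reindexes (↑ʳ-reindexes zs env') h)) φ)

    evalCQ-atomCQ : ∀ {m} (env : Vec (Fin N) m) a → evalCQ s env (atomCQ a) ≡ evalAtom s env a
    evalCQ-atomCQ env a = trans (∧-identityʳ _) (evalAtom-rename (↑ˡ-reindexes env []) a)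

    evalCQ-conjCQ : ∀ {m} (env : Vec (Fin N) m) p q →
                    evalCQ s env (conjCQ p q) ≡ evalCQ s env p ∧ evalCQ s env q
    evalCQ-conjCQ {m} env (cq e₁ as₁) (cq e₂ as₂) = begin
      existsTuple (e₁ + e₂) (λ y → holdsAll s (env ++ y) (bs₁ ++ₗ bs₂))
        ≡⟨ existsTuple-+ e₁ e₂ _ ⟩
      existsTuple e₁ (λ y₁ → existsTuple e₂ (λ y₂ → holdsAll s (env ++ (y₁ ++ y₂)) (bs₁ ++ₗ bs₂)))
        ≡⟨ existsTuple-cong e₁ (λ y₁ → existsTuple-cong e₂ (separate y₁)) ⟩
      existsTuple e₁ (λ y₁ → existsTuple e₂ (λ y₂ → holdsAll s (env ++ y₁) as₁ ∧ holdsAll s (env ++ y₂) as₂))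
        ≡⟨ existsTuple-cong e₁ (λ y₁ → existsTuple-∧ˡ e₂ (holdsAll s (env ++ y₁) as₁) _) ⟩
      existsTuple e₁ (λ y₁ → holdsAll s (env ++ y₁) as₁ ∧ evalCQ s env (cq e₂ as₂))
        ≡⟨ existsTuple-∧ʳ e₁ _ _ ⟩
      evalCQ s env (cq e₁ as₁) ∧ evalCQ s env (cq e₂ as₂) ∎
      where
      bs₁ : List (CQAtom σ ρ (m + (e₁ + e₂)))
      bs₁ = lmap (renameAtom (conjunctˡ e₁ e₂)) as₁
      bs₂ : List (CQAtom σ ρ (m + (e₁ + e₂)))
      bs₂ = lmap (renameAtom (conjunctʳ e₁ e₂)) as₂
      separate : ∀ y₁ y₂ → holdsAll s (env ++ (y₁ ++ y₂)) (bs₁ ++ₗ bs₂) ≡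
                           holdsAll s (env ++ y₁) as₁ ∧ holdsAll s (env ++ y₂) as₂
      separate y₁ y₂ = trans (holdsAll-++ (env ++ (y₁ ++ y₂)) bs₁ bs₂) (cong₂ _∧_
        (holdsAll-rename (⊕-reindexes (↑ˡ-reindexes env (y₁ ++ y₂))
                           (∘-reindexes (↑ʳ-reindexes env (y₁ ++ y₂)) (↑ˡ-reindexes y₁ y₂))) as₁)
        (holdsAll-rename (⊕-reindexes (↑ˡ-reindexes env (y₁ ++ y₂))
                           (∘-reindexes (↑ʳ-reindexes env (y₁ ++ y₂)) (↑ʳ-reindexes y₁ y₂))) as₂))

    evalCQ-existsCQ : ∀ {m} k (env : Vec (Fin N) m) p →
                      evalCQ s env (existsCQ k p) ≡ existsTuple k (λ zs → evalCQ s (zs ++ env) p)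
    evalCQ-existsCQ k env (cq e as) = trans (existsTuple-+ k e _)
      (existsTuple-cong k (λ zs → existsTuple-cong e (λ y → holdsAll-rename
        (⊕-reindexes (⊕-reindexes (∘-reindexes (↑ʳ-reindexes env (zs ++ y)) (↑ˡ-reindexes zs y))
                                  (↑ˡ-reindexes env (zs ++ y)))
                     (∘-reindexes (↑ʳ-reindexes env (zs ++ y)) (↑ʳ-reindexes zs y))) as)))

    toCQ-correct : ∀ {m} (env : Vec (Fin N) m) φ → evalCQ s env (toCQ φ) ≡ holds s env φ
    toCQ-correct env (atom a) = evalCQ-atomCQ env a
    toCQ-correct env ⊤ᶜ       = refl
    toCQ-correct env (φ ∧ᶜ ψ) =
      trans (evalCQ-conjCQ env (toCQ φ) (toCQ ψ)) (cong₂ _∧_ (toCQ-correct env φ) (toCQ-correct env ψ))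
    toCQ-correct env (∃ᶜ k φ) =
      trans (evalCQ-existsCQ k env (toCQ φ)) (existsTuple-cong k (λ zs → toCQ-correct (zs ++ env) φ))

-- Expressions over operations with conjunctive-query-definable graphs

graph : ∀ {N k} → (Vec (Fin N) k → Fin N) → Rel N (suc k)
graph h (v ∷ xs) = ⌊ v ≟F h xs ⌋

module Expressions {G : Set} (arity : G → ℕ) where

  data Expr (m : ℕ) : Set where
    var : Fin m → Expr m
    app : (g : G) → Vec (Expr m) (arity g) → Expr m

  vars : ∀ {k m} → (Fin k → Fin m) → Vec (Expr m) k
  vars f = tabulate (var ∘ f)

  module _ {D : Set} (⟦_⟧ : (g : G) → Vec D (arity g) → D) where

    mutual
      evalExpr : ∀ {m} → Vec D m → Expr m → D
      evalExpr env (var x)    = lookup env x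
      evalExpr env (app g es) = ⟦ g ⟧ (evalExprs env es)

      evalExprs : ∀ {m k} → Vec D m → Vec (Expr m) k → Vec D k
      evalExprs env []       = []
      evalExprs env (e ∷ es) = evalExpr env e ∷ evalExprs env es

    evalExprs-vars : ∀ {k m} {f : Fin k → Fin m} {xs} {env : Vec D m} →
                     Reindexes f xs env → evalExprs env (vars f) ≡ xs
    evalExprs-vars {f = f} {env = env} h = trans (tabulated f) (tabulate-reindexes h)
      where
      tabulated : ∀ {k} (f : Fin k → Fin _) → evalExprs env (vars f) ≡ tabulate (lookup env ∘ f)
      tabulated {zero}  f = refl
      tabulated {suc k} f = cong (lookup env (f zero) ∷_) (tabulated (f ∘ suc))

module ExprCompilation (σ : InSchema) (ρ : CQAuxSchema) {G : Set} (arity : G → ℕ)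
  (graphAtom : ∀ {m} (g : G) → Vec (Fin m) (suc (arity g)) → CQAtom σ ρ m) where

  open ConjunctiveFormulas σ ρ
  open Expressions arity

  skipResult : ∀ {m} k → Fin (k + m) → Fin (k + suc m)
  skipResult {m} k = (λ (i : Fin k) → i ↑ˡ suc m) ⊕ ((k ↑ʳ_) ∘ suc)

  resultAndArguments : ∀ {m} k → Vec (Fin (k + suc m)) (suc k)
  resultAndArguments {m} k = tabulate ((k ↑ʳ zero) ◂ (_↑ˡ suc m))

  mutual
    compile : ∀ {m} → Expr m → ConjFormula (suc m)
    compile (var x)    = atom (eq zero (suc x))
    compile (app g es) = ∃ᶜ (arity g)
      (renameᶜ (skipResult (arity g)) (compiles es) ∧ᶜ atom (graphAtom g (resultAndArguments (arity g))))

    compiles : ∀ {m k} → Vec (Expr m) k → ConjFormula (k + m)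
    compiles []                  = ⊤ᶜ
    compiles {k = suc k} (e ∷ es) = renameᶜ (zero ◂ (suc ∘ (k ↑ʳ_))) (compile e) ∧ᶜ renameᶜ suc (compiles es)

  module _ {N} (s : CQState σ ρ N) (⟦_⟧ : (g : G) → Vec (Fin N) (arity g) → Fin N)
    (graph-holds : ∀ {m} g (env : Vec (Fin N) m) vs →
                   evalAtom s env (graphAtom g vs) ≡ graph ⟦ g ⟧ (vmap (lookup env) vs)) where

    mutual
      compile-correct : ∀ {m} e (env : Vec (Fin N) m) y →
                        holds s (y ∷ env) (compile e) ≡ ⌊ y ≟F evalExpr ⟦_⟧ env e ⌋
      compile-correct (var x)    env y = refl
      compile-correct (app g es) env y =
        trans (existsTuple-cong k (λ zs → cong₂ _∧_ (arguments zs) (result zs)))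
              (existsTuple-onePoint k ws (λ zs → ⌊ y ≟F ⟦ g ⟧ zs ⌋))
        where
        k : ℕ
        k = arity g
        ws : Vec (Fin N) k
        ws = evalExprs ⟦_⟧ env es
        arguments : ∀ zs → holds s (zs ++ y ∷ env) (renameᶜ (skipResult k) (compiles es)) ≡ ⌊ zs ≟V ws ⌋
        arguments zs = trans
          (holds-rename s (⊕-reindexes (↑ˡ-reindexes zs (y ∷ env))
                             (∘-reindexes (↑ʳ-reindexes zs (y ∷ env)) (↑ʳ-reindexes (y ∷ []) env)))
                        (compiles es))
          (compiles-correct es env zs)
        result : ∀ zs → evalAtom s (zs ++ y ∷ env) (graphAtom g (resultAndArguments k)) ≡ ⌊ y ≟F ⟦ g ⟧ zs ⌋
        result zs = trans (graph-holds g (zs ++ y ∷ env) (resultAndArguments k))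
          (cong (graph ⟦ g ⟧) (trans (≡.sym (tabulate-∘ (lookup (zs ++ y ∷ env)) ((k ↑ʳ zero) ◂ (_↑ˡ suc _))))
            (tabulate-reindexes (◂-reindexes (lookup-++ʳ zs (y ∷ env) zero) (↑ˡ-reindexes zs (y ∷ env))))))

      compiles-correct : ∀ {m k} es (env : Vec (Fin N) m) (zs : Vec (Fin N) k) →
                         holds s (zs ++ env) (compiles es) ≡ ⌊ zs ≟V evalExprs ⟦_⟧ env es ⌋
      compiles-correct []       env []       = refl
      compiles-correct (e ∷ es) env (z ∷ zs) = trans
        (cong₂ _∧_
          (trans (holds-rename s (◂-reindexes refl (∘-reindexes (↑ʳ-reindexes (z ∷ []) (zs ++ env))
                                                                (↑ʳ-reindexes zs env))) (compile e))
                 (compile-correct e env z))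
          (trans (holds-rename s (↑ʳ-reindexes (z ∷ []) (zs ++ env)) (compiles es))
                 (compiles-correct es env zs)))
        (≡.sym (⌊∷≟∷⌋ z _ zs _))

-- On Fin 1 the two truth values coincide.
⌜_⌝ : ∀ {n} → Bool → Fin (suc n)
⌜_⌝ {zero}  _     = zero
⌜_⌝ {suc n} false = zero
⌜_⌝ {suc n} true  = suc zero

isOne : ∀ {n} → Fin (suc n) → Bool
isOne x = ⌊ x ≟F ⌜ true ⌝ ⌋

isOne-⌜⌝ : ∀ {n} b → isOne {suc n} ⌜ b ⌝ ≡ b
isOne-⌜⌝ false = refl
isOne-⌜⌝ true  = refl

Fin1-unique : (x y : Fin 1) → x ≡ y
Fin1-unique zero zero = refl

if-isOne-⌜⌝ : ∀ {n} b {x y : Fin (suc n)} → (if isOne {n} ⌜ b ⌝ then x else y) ≡ (if b then x else y)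
if-isOne-⌜⌝ {zero}  b         = Fin1-unique _ _
if-isOne-⌜⌝ {suc n} b {x} {y} = cong (if_then x else y) (isOne-⌜⌝ b)

Fin1-tuple-unique : ∀ {k} (v : Vec (Fin 1) k) → v ≡ replicate k zero
Fin1-tuple-unique []         = refl
Fin1-tuple-unique (zero ∷ v) = cong (zero ∷_) (Fin1-tuple-unique v)

funToFin-cong : ∀ {m n} {f g : Fin m → Fin n} → f ≗ g → funToFin f ≡ funToFin g
funToFin-cong {zero}  h = refl
funToFin-cong {suc m} h = cong₂ combine (h zero) (funToFin-cong (h ∘ suc))

applyMod-cong : ∀ {σ N} {I J : InDB σ N} → (∀ S v → I S v ≡ J S v) →
                ∀ δ S v → applyMod δ I S v ≡ applyMod δ J S v
applyMod-cong I≗J (mod k S a) S' v with S' ≟F S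
... | no _     = I≗J S' v
... | yes refl with k
...   | ins = cong (_∨ _) (I≗J S v)
...   | del = cong (_∧ _) (I≗J S v)

module Agreement {σ : InSchema} {ρ : QFAuxSchema} {N : ℕ} where

  record _≈_ (q q' : QFState σ ρ N) : Set where
    field
      rel≈ : ∀ R v → relQF q R v ≡ relQF q' R v
      fun≈ : ∀ f v → funA (qAuxDB q) f v ≡ funA (qAuxDB q') f v
  open _≈_ public

  module _ {q q' : QFState σ ρ N} (q≈q' : q ≈ q') where
    mutual
      evalT-≈ : ∀ {m} (env : Vec (Fin N) m) t → evalT q env t ≡ evalT q' env t
      evalT-≈ env (var x)     = refl
      evalT-≈ env (app f ts)  = trans (fun≈ q≈q' f _) (cong (funA (qAuxDB q') f) (evalTs-≈ env ts))
      evalT-≈ env (ite φ t u) = trans (cong (if_then evalT q env t else evalT q env u) (evalF-≈ env φ))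
                                      (cong₂ (if evalF q' env φ then_else_) (evalT-≈ env t) (evalT-≈ env u))

      evalTs-≈ : ∀ {m k} (env : Vec (Fin N) m) (ts : Vec (Term σ ρ m) k) → evalTs q env ts ≡ evalTs q' env ts
      evalTs-≈ env []       = refl
      evalTs-≈ env (t ∷ ts) = cong₂ _∷_ (evalT-≈ env t) (evalTs-≈ env ts)

      evalF-≈ : ∀ {m} (env : Vec (Fin N) m) φ → evalF q env φ ≡ evalF q' env φ
      evalF-≈ env (rel R ts) = trans (rel≈ q≈q' R _) (cong (relQF q' R) (evalTs-≈ env ts))
      evalF-≈ env (eq t u)   = cong₂ (λ x y → ⌊ x ≟F y ⌋) (evalT-≈ env t) (evalT-≈ env u)
      evalF-≈ env (neg φ)    = cong not (evalF-≈ env φ)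
      evalF-≈ env (conj φ ψ) = cong₂ _∧_ (evalF-≈ env φ) (evalF-≈ env ψ)
      evalF-≈ env (disj φ ψ) = cong₂ _∨_ (evalF-≈ env φ) (evalF-≈ env ψ)

-- The simulation

module Simulation {σ : InSchema} (P : QFProgram σ) where

  ρ : QFAuxSchema
  ρ = qfAuxSch P

  nI nR nF K : ℕ
  nI = nIn σ
  nR = nRel ρ
  nF = nFun ρ
  K  = nI + nR

  Qs : Fin nR
  Qs = qfQSym P

  data Op : Set where
    χ     : Fin nI ⊎ Fin nR → Op
    fun   : Fin nF → Op
    equal : Op
    cond  : Op
    const : Bool → Op

  arity : Op → ℕ
  arity (χ R)     = arQF σ ρ R
  arity (fun f)   = arFun ρ f
  arity equal     = 2
  arity cond      = 3
  arity (const _) = 0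

  open Expressions arity

  equalOp : ∀ {n} → Vec (Fin (suc n)) 2 → Fin (suc n)
  equalOp (x ∷ y ∷ []) = ⌜ ⌊ x ≟F y ⌋ ⌝

  condOp : ∀ {n} → Vec (Fin (suc n)) 3 → Fin (suc n)
  condOp (w ∷ x ∷ y ∷ []) = if isOne w then x else y

  interpret : ∀ {n} → QFState σ ρ (suc n) → (g : Op) → Vec (Fin (suc n)) (arity g) → Fin (suc n)
  interpret q (χ R) xs    = ⌜ relQF q R xs ⌝
  interpret q (fun f)     = funA (qAuxDB q) f
  interpret q equal       = equalOp
  interpret q cond        = condOp
  interpret q (const b) _ = ⌜ b ⌝

  evalᵉ : ∀ {n m} → QFState σ ρ (suc n) → Vec (Fin (suc n)) m → Expr m → Fin (suc n)
  evalᵉ q = evalExpr (interpret q)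

  iteᵉ : ∀ {m} → Expr m → Expr m → Expr m → Expr m
  iteᵉ a b c = app cond (a ∷ b ∷ c ∷ [])

  constᵉ : ∀ {m} → Bool → Expr m
  constᵉ b = app (const b) []

  ¬ᵉ_ : ∀ {m} → Expr m → Expr m
  ¬ᵉ a = iteᵉ a (constᵉ false) (constᵉ true)

  _∧ᵉ_ _∨ᵉ_ : ∀ {m} → Expr m → Expr m → Expr m
  a ∧ᵉ b = iteᵉ a b (constᵉ false)
  a ∨ᵉ b = iteᵉ a (constᵉ true) b

  _≡ᵉ_ : ∀ {m k} → Vec (Expr m) k → Vec (Expr m) k → Expr m
  []       ≡ᵉ []         = constᵉ true
  (a ∷ as) ≡ᵉ (b ∷ bs) = app equal (a ∷ b ∷ []) ∧ᵉ (as ≡ᵉ bs)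

  updRelᵉ : ∀ {m} → Kind → Expr m → Expr m → Expr m
  updRelᵉ ins old hit = old ∨ᵉ hit
  updRelᵉ del old hit = old ∧ᵉ (¬ᵉ hit)

  mutual
    ⌈_⌉ᵗ : ∀ {m} → Term σ ρ m → Expr m
    ⌈ var x ⌉ᵗ     = var x
    ⌈ app f ts ⌉ᵗ  = app (fun f) ⌈ ts ⌉ᵗˢ
    ⌈ ite φ t u ⌉ᵗ = iteᵉ ⌈ φ ⌉ᶠ ⌈ t ⌉ᵗ ⌈ u ⌉ᵗ

    ⌈_⌉ᵗˢ : ∀ {m k} → Vec (Term σ ρ m) k → Vec (Expr m) k
    ⌈ [] ⌉ᵗˢ     = []
    ⌈ t ∷ ts ⌉ᵗˢ = ⌈ t ⌉ᵗ ∷ ⌈ ts ⌉ᵗˢ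

    ⌈_⌉ᶠ : ∀ {m} → Formula σ ρ m → Expr m
    ⌈ rel R ts ⌉ᶠ = app (χ R) ⌈ ts ⌉ᵗˢ
    ⌈ eq t u ⌉ᶠ   = app equal (⌈ t ⌉ᵗ ∷ ⌈ u ⌉ᵗ ∷ [])
    ⌈ neg φ ⌉ᶠ    = ¬ᵉ ⌈ φ ⌉ᶠ
    ⌈ conj φ ψ ⌉ᶠ = ⌈ φ ⌉ᶠ ∧ᵉ ⌈ ψ ⌉ᶠ
    ⌈ disj φ ψ ⌉ᶠ = ⌈ φ ⌉ᶠ ∨ᵉ ⌈ ψ ⌉ᶠ

  inputUpdate : Kind → (S S' : Fin nI) → Expr (arIn σ S + arIn σ S')
  inputUpdate k S S' with S' ≟F S
  ... | no _     = app (χ (inj₁ S')) (vars (arIn σ S ↑ʳ_))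
  ... | yes refl = updRelᵉ k (app (χ (inj₁ S)) (vars (arIn σ S ↑ʳ_)))
                             (vars (arIn σ S ↑ʳ_) ≡ᵉ vars (_↑ˡ arIn σ S))

  newValue : Kind → (S : Fin nI) → (g : Op) → Expr (arIn σ S + arity g)
  newValue k S (χ (inj₁ S')) = inputUpdate k S S'
  newValue k S (χ (inj₂ R))  = ⌈ updateRel P k S R ⌉ᶠ
  newValue k S (fun f)       = ⌈ updateFun P k S f ⌉ᵗ
  newValue k S equal         = app equal (vars (arIn σ S ↑ʳ_))
  newValue k S cond          = app cond (vars (arIn σ S ↑ʳ_))
  newValue k S (const b)     = constᵉ b

  module _ {n} (q : QFState σ ρ (suc n)) where

    module _ {m} (env : Vec (Fin (suc n)) m) where

      iteᵉ-correct : ∀ a b c {β x y} → evalᵉ q env a ≡ ⌜ β ⌝ → evalᵉ q env b ≡ x → evalᵉ q env c ≡ y →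
                     evalᵉ q env (iteᵉ a b c) ≡ (if β then x else y)
      iteᵉ-correct a b c {β} {x} {y} ha hb hc = begin
        (if isOne (evalᵉ q env a) then evalᵉ q env b else evalᵉ q env c)
          ≡⟨ cong (if_then evalᵉ q env b else evalᵉ q env c) (cong isOne ha) ⟩
        (if isOne ⌜ β ⌝ then evalᵉ q env b else evalᵉ q env c)
          ≡⟨ cong₂ (if isOne ⌜ β ⌝ then_else_) hb hc ⟩
        (if isOne ⌜ β ⌝ then x else y)
          ≡⟨ if-isOne-⌜⌝ β ⟩
        (if β then x else y) ∎

      ¬ᵉ-correct : ∀ a {β} → evalᵉ q env a ≡ ⌜ β ⌝ → evalᵉ q env (¬ᵉ a) ≡ ⌜ not β ⌝
      ¬ᵉ-correct a {false} ha = iteᵉ-correct a (constᵉ false) (constᵉ true) ha refl refl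
      ¬ᵉ-correct a {true}  ha = iteᵉ-correct a (constᵉ false) (constᵉ true) ha refl refl

      ∧ᵉ-correct : ∀ a b {β γ} → evalᵉ q env a ≡ ⌜ β ⌝ → evalᵉ q env b ≡ ⌜ γ ⌝ →
                   evalᵉ q env (a ∧ᵉ b) ≡ ⌜ β ∧ γ ⌝
      ∧ᵉ-correct a b {false} ha hb = iteᵉ-correct a b (constᵉ false) ha hb refl
      ∧ᵉ-correct a b {true}  ha hb = iteᵉ-correct a b (constᵉ false) ha hb refl

      ∨ᵉ-correct : ∀ a b {β γ} → evalᵉ q env a ≡ ⌜ β ⌝ → evalᵉ q env b ≡ ⌜ γ ⌝ →
                   evalᵉ q env (a ∨ᵉ b) ≡ ⌜ β ∨ γ ⌝
      ∨ᵉ-correct a b {false} ha hb = iteᵉ-correct a (constᵉ true) b ha refl hb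
      ∨ᵉ-correct a b {true}  ha hb = iteᵉ-correct a (constᵉ true) b ha refl hb

      ≡ᵉ-correct : ∀ {k} (as bs : Vec (Expr m) k) →
                   evalᵉ q env (as ≡ᵉ bs) ≡
                   ⌜ ⌊ evalExprs (interpret q) env as ≟V evalExprs (interpret q) env bs ⌋ ⌝
      ≡ᵉ-correct []       []       = refl
      ≡ᵉ-correct (a ∷ as) (b ∷ bs) =
        trans (∧ᵉ-correct (app equal (a ∷ b ∷ [])) (as ≡ᵉ bs) refl (≡ᵉ-correct as bs))
              (cong ⌜_⌝ (≡.sym (⌊∷≟∷⌋ _ _ _ _)))

      updRelᵉ-correct : ∀ k old hit {j} {R : Rel (suc n) j} {a b} →
                        evalᵉ q env old ≡ ⌜ R b ⌝ → evalᵉ q env hit ≡ ⌜ ⌊ b ≟V a ⌋ ⌝ →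
                        evalᵉ q env (updRelᵉ k old hit) ≡ ⌜ updRel k a R b ⌝
      updRelᵉ-correct ins old hit hold hhit = ∨ᵉ-correct old hit hold hhit
      updRelᵉ-correct del old hit hold hhit = ∧ᵉ-correct old (¬ᵉ hit) hold (¬ᵉ-correct hit hhit)

    mutual
      ⌈⌉ᵗ-correct : ∀ {m} (env : Vec (Fin (suc n)) m) t → evalᵉ q env ⌈ t ⌉ᵗ ≡ evalT q env t
      ⌈⌉ᵗ-correct env (var x)     = refl
      ⌈⌉ᵗ-correct env (app f ts)  = cong (funA (qAuxDB q) f) (⌈⌉ᵗˢ-correct env ts)
      ⌈⌉ᵗ-correct env (ite φ t u) =
        iteᵉ-correct env ⌈ φ ⌉ᶠ ⌈ t ⌉ᵗ ⌈ u ⌉ᵗ (⌈⌉ᶠ-correct env φ) (⌈⌉ᵗ-correct env t) (⌈⌉ᵗ-correct env u)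

      ⌈⌉ᵗˢ-correct : ∀ {m k} (env : Vec (Fin (suc n)) m) (ts : Vec (Term σ ρ m) k) →
                     evalExprs (interpret q) env ⌈ ts ⌉ᵗˢ ≡ evalTs q env ts
      ⌈⌉ᵗˢ-correct env []       = refl
      ⌈⌉ᵗˢ-correct env (t ∷ ts) = cong₂ _∷_ (⌈⌉ᵗ-correct env t) (⌈⌉ᵗˢ-correct env ts)

      ⌈⌉ᶠ-correct : ∀ {m} (env : Vec (Fin (suc n)) m) φ → evalᵉ q env ⌈ φ ⌉ᶠ ≡ ⌜ evalF q env φ ⌝
      ⌈⌉ᶠ-correct env (rel R ts) = cong (λ xs → ⌜ relQF q R xs ⌝) (⌈⌉ᵗˢ-correct env ts)
      ⌈⌉ᶠ-correct env (eq t u)   = cong₂ (λ x y → ⌜ ⌊ x ≟F y ⌋ ⌝) (⌈⌉ᵗ-correct env t) (⌈⌉ᵗ-correct env u)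
      ⌈⌉ᶠ-correct env (neg φ)    = ¬ᵉ-correct env ⌈ φ ⌉ᶠ (⌈⌉ᶠ-correct env φ)
      ⌈⌉ᶠ-correct env (conj φ ψ) = ∧ᵉ-correct env ⌈ φ ⌉ᶠ ⌈ ψ ⌉ᶠ (⌈⌉ᶠ-correct env φ) (⌈⌉ᶠ-correct env ψ)
      ⌈⌉ᶠ-correct env (disj φ ψ) = ∨ᵉ-correct env ⌈ φ ⌉ᶠ ⌈ ψ ⌉ᶠ (⌈⌉ᶠ-correct env φ) (⌈⌉ᶠ-correct env ψ)

    inputUpdate-correct : ∀ k S S' a xs →
      evalᵉ q (a ++ xs) (inputUpdate k S S') ≡ ⌜ applyMod (mod k S a) (qInDB q) S' xs ⌝
    inputUpdate-correct k S S' a xs with S' ≟F S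
    ... | no _     = cong (λ v → ⌜ qInDB q S' v ⌝) (evalExprs-vars (interpret q) (↑ʳ-reindexes a xs))
    ... | yes refl = updRelᵉ-correct (a ++ xs) k (app (χ (inj₁ S)) (vars (arIn σ S ↑ʳ_)))
                                                 (vars (arIn σ S ↑ʳ_) ≡ᵉ vars (_↑ˡ arIn σ S))
      (cong (λ v → ⌜ qInDB q S v ⌝) (evalExprs-vars (interpret q) (↑ʳ-reindexes a xs)))
      (trans (≡ᵉ-correct (a ++ xs) (vars (arIn σ S ↑ʳ_)) (vars (_↑ˡ arIn σ S)))
             (cong₂ (λ u w → ⌜ ⌊ u ≟V w ⌋ ⌝) (evalExprs-vars (interpret q) (↑ʳ-reindexes a xs))
                                             (evalExprs-vars (interpret q) (↑ˡ-reindexes a xs))))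

    newValue-correct : ∀ k S g a xs →
      evalᵉ q (a ++ xs) (newValue k S g) ≡ interpret (stepQF P q (mod k S a)) g xs
    newValue-correct k S (χ (inj₁ S')) a xs = inputUpdate-correct k S S' a xs
    newValue-correct k S (χ (inj₂ R))  a xs = ⌈⌉ᶠ-correct (a ++ xs) (updateRel P k S R)
    newValue-correct k S (fun f)       a xs = ⌈⌉ᵗ-correct (a ++ xs) (updateFun P k S f)
    newValue-correct k S equal         a xs = cong equalOp (evalExprs-vars (interpret q) (↑ʳ-reindexes a xs))
    newValue-correct k S cond          a xs = cong condOp (evalExprs-vars (interpret q) (↑ʳ-reindexes a xs))
    newValue-correct k S (const b)     a xs = refl

  open Agreement

  step-≈ : ∀ {N} {q q' : QFState σ ρ N} → q ≈ q' → ∀ δ → stepQF P q δ ≈ stepQF P q' δ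
  rel≈ (step-≈ q≈q' δ)           (inj₁ S') v = applyMod-cong (λ S → rel≈ q≈q' (inj₁ S)) δ S' v
  rel≈ (step-≈ q≈q' (mod k S a)) (inj₂ R)  v = evalF-≈ q≈q' (a ++ v) (updateRel P k S R)
  fun≈ (step-≈ q≈q' (mod k S a)) f         v = evalT-≈ q≈q' (a ++ v) (updateFun P k S f)

  origin : ∀ k → Vec (Fin 1) k
  origin k = replicate k zero

  relationBit : QFState σ ρ 1 → Fin nI ⊎ Fin nR → Bool
  relationBit q R = relQF q R (origin _)

  code : QFState σ ρ 1 → Fin (2 ^ K)
  code q = funToFin (⌜_⌝ ∘ relationBit q ∘ splitAt nI)

  bit : Fin (2 ^ K) → Fin nI ⊎ Fin nR → Bool
  bit c R = isOne (finToFun c (join nI nR R))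

  pointState : Fin (2 ^ K) → QFState σ ρ 1
  pointState c = qst (λ S _ → bit c (inj₁ S)) (aux (λ R _ → bit c (inj₂ R)) (λ _ _ → zero))

  bit-code : ∀ q R → bit (code q) R ≡ relationBit q R
  bit-code q R = begin
    isOne (finToFun (code q) (join nI nR R))
      ≡⟨ cong isOne (finToFun-funToFin _ (join nI nR R)) ⟩
    isOne ⌜ relationBit q (splitAt nI (join nI nR R)) ⌝
      ≡⟨ cong (isOne ∘ ⌜_⌝ ∘ relationBit q) (splitAt-join nI nR R) ⟩
    isOne ⌜ relationBit q R ⌝
      ≡⟨ isOne-⌜⌝ (relationBit q R) ⟩
    relationBit q R ∎

  ≈-pointState-code : ∀ q → q ≈ pointState (code q)
  rel≈ (≈-pointState-code q) (inj₁ S) v =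
    trans (cong (relQF q (inj₁ S)) (Fin1-tuple-unique v)) (≡.sym (bit-code q (inj₁ S)))
  rel≈ (≈-pointState-code q) (inj₂ R) v =
    trans (cong (relQF q (inj₂ R)) (Fin1-tuple-unique v)) (≡.sym (bit-code q (inj₂ R)))
  fun≈ (≈-pointState-code q) f v = Fin1-unique _ _

  code-≈ : ∀ {q q'} → q ≈ q' → code q ≡ code q'
  code-≈ q≈q' = funToFin-cong (λ i → cong ⌜_⌝ (rel≈ q≈q' (splitAt nI i) (origin _)))

  stepCode : Kind → Fin nI → Fin (2 ^ K) → Fin (2 ^ K)
  stepCode k S c = code (stepQF P (pointState c) (mod k S (origin _)))

  code-step : ∀ q k S a → code (stepQF P q (mod k S a)) ≡ stepCode k S (code q)
  code-step q k S a = trans (cong (λ a → code (stepQF P q (mod k S a))) (Fin1-tuple-unique a))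
                            (code-≈ (step-≈ (≈-pointState-code q) (mod k S (origin _))))

  -- On larger domains this is conjoined to the query update, so it must be true there.
  pointTruth : ∀ n → QFState σ ρ (suc n) → Fin (2 ^ 2 ^ K) → Bool
  pointTruth zero    q g = isOne (finToFun g (code q))
  pointTruth (suc n) q g = true

  precompose : Fin (2 ^ 2 ^ K) → (Fin (2 ^ K) → Fin (2 ^ K)) → Fin (2 ^ 2 ^ K)
  precompose g F = funToFin (finToFun g ∘ F)

  pointTruth-step : ∀ n (q : QFState σ ρ (suc n)) k S a g →
    pointTruth n q (precompose g (stepCode k S)) ≡ pointTruth n (stepQF P q (mod k S a)) g
  pointTruth-step zero    q k S a g = begin
    isOne (finToFun (funToFin (finToFun g ∘ stepCode k S)) (code q))  ≡⟨ cong isOne (finToFun-funToFin _ (code q)) ⟩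
    isOne (finToFun g (stepCode k S (code q)))                         ≡⟨ cong (isOne ∘ finToFun g) (code-step q k S a) ⟨
    isOne (finToFun g (code (stepQF P q (mod k S a))))                 ∎
  pointTruth-step (suc n) q k S a g = refl

  queryBit : Fin (2 ^ 2 ^ K)
  queryBit = funToFin (λ c → finToFun c (nI ↑ʳ Qs))

  query-readout : ∀ n (q : QFState σ ρ (suc n)) b →
    isOne {n} ⌜ relA (qAuxDB q) Qs b ⌝ ∧ pointTruth n q queryBit ≡ relA (qAuxDB q) Qs b
  query-readout zero    q b = begin
    isOne {0} ⌜ relA (qAuxDB q) Qs b ⌝ ∧ isOne (finToFun queryBit (code q))
      ≡⟨ cong isOne (finToFun-funToFin (λ c → finToFun c (nI ↑ʳ Qs)) (code q)) ⟩
    bit (code q) (inj₂ Qs)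
      ≡⟨ bit-code q (inj₂ Qs) ⟩
    relA (qAuxDB q) Qs (origin _)
      ≡⟨ cong (relA (qAuxDB q) Qs) (Fin1-tuple-unique b) ⟨
    relA (qAuxDB q) Qs b ∎
  query-readout (suc n) q b = trans (∧-identityʳ _) (isOne-⌜⌝ _)

  data Sym : Set where
    graphOf   : Op → Sym
    query     : Sym
    pointTest : Fin (2 ^ 2 ^ K) → Sym

  arSym : Sym → ℕ
  arSym (graphOf g)   = suc (arity g)
  arSym query         = arRel ρ Qs
  arSym (pointTest _) = 0

  nOp nSym : ℕ
  nOp  = K + (nF + 4)
  nSym = nOp + suc (2 ^ 2 ^ K)

  fixedOps : Vec Op 4
  fixedOps = equal ∷ cond ∷ const false ∷ const true ∷ []

  decodeOp : Fin nOp → Op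
  decodeOp i = [ χ ∘ splitAt nI , [ fun , lookup fixedOps ] ∘ splitAt nF ] (splitAt K i)

  encodeOp : Op → Fin nOp
  encodeOp (χ R)         = join nI nR R ↑ˡ (nF + 4)
  encodeOp (fun f)       = K ↑ʳ (f ↑ˡ 4)
  encodeOp equal         = K ↑ʳ (nF ↑ʳ zero)
  encodeOp cond          = K ↑ʳ (nF ↑ʳ suc zero)
  encodeOp (const false) = K ↑ʳ (nF ↑ʳ suc (suc zero))
  encodeOp (const true)  = K ↑ʳ (nF ↑ʳ suc (suc (suc zero)))

  decodeOp-fixed : ∀ i → decodeOp (K ↑ʳ (nF ↑ʳ i)) ≡ lookup fixedOps i
  decodeOp-fixed i rewrite splitAt-↑ʳ K (nF + 4) (nF ↑ʳ i) | splitAt-↑ʳ nF 4 i = refl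

  decodeOp-encodeOp : ∀ g → decodeOp (encodeOp g) ≡ g
  decodeOp-encodeOp (χ R) rewrite splitAt-↑ˡ K (join nI nR R) (nF + 4) | splitAt-join nI nR R = refl
  decodeOp-encodeOp (fun f) rewrite splitAt-↑ʳ K (nF + 4) (f ↑ˡ 4) | splitAt-↑ˡ nF f 4 = refl
  decodeOp-encodeOp equal         = decodeOp-fixed _
  decodeOp-encodeOp cond          = decodeOp-fixed _
  decodeOp-encodeOp (const false) = decodeOp-fixed _
  decodeOp-encodeOp (const true)  = decodeOp-fixed _

  decode : Fin nSym → Sym
  decode i = [ graphOf ∘ decodeOp , query ◂ pointTest ] (splitAt nOp i)

  encode : Sym → Fin nSym
  encode (graphOf g)   = encodeOp g ↑ˡ suc (2 ^ 2 ^ K)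
  encode query         = nOp ↑ʳ zero
  encode (pointTest g) = nOp ↑ʳ suc g

  decode-encode : ∀ s → decode (encode s) ≡ s
  decode-encode (graphOf g) rewrite splitAt-↑ˡ nOp (encodeOp g) (suc (2 ^ 2 ^ K)) =
    cong graphOf (decodeOp-encodeOp g)
  decode-encode query         rewrite splitAt-↑ʳ nOp (suc (2 ^ 2 ^ K)) zero = refl
  decode-encode (pointTest g) rewrite splitAt-↑ʳ nOp (suc (2 ^ 2 ^ K)) (suc g) = refl

  schema : CQAuxSchema
  schema = record { nAux = nSym ; arAux = arSym ∘ decode }

  open ConjunctiveFormulas σ schema

  symAtom : ∀ {m} (s : Sym) → Vec (Fin m) (arSym s) → CQAtom σ schema m
  symAtom s vs = rel (inj₂ (encode s)) (≡.subst (Vec (Fin _)) (cong arSym (≡.sym (decode-encode s))) vs)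

  open ExprCompilation σ schema arity (symAtom ∘ graphOf)

  meaning : ∀ {n} → QFState σ ρ (suc n) → (s : Sym) → Rel (suc n) (arSym s)
  meaning q     (graphOf g)   = graph (interpret q g)
  meaning q     query         = relA (qAuxDB q) Qs
  meaning {n} q (pointTest g) _ = pointTruth n q g

  record Simulates {n} (c : CQState σ schema (suc n)) (q : QFState σ ρ (suc n)) : Set where
    constructor simulates
    field
      auxDB≡meaning : ∀ R b → auxDB c R b ≡ meaning q (decode R) b
  open Simulates public

  placeResult : ∀ s r → Fin (suc (s + r)) → Fin (s + suc r)
  placeResult s r = (s ↑ʳ zero) ◂ ((λ (i : Fin s) → i ↑ˡ suc r) ⊕ ((s ↑ʳ_) ∘ suc))

  updateFormula : Kind → (S : Fin nI) → (s : Sym) → ConjFormula (arIn σ S + arSym s)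
  updateFormula k S (graphOf g)   = renameᶜ (placeResult (arIn σ S) (arity g)) (compile (newValue k S g))
  updateFormula k S query         =
    ∃ᶜ 1 (compile ⌈ updateRel P k S Qs ⌉ᶠ ∧ᶜ atom (symAtom (graphOf (const true)) (zero ∷ [])))
    ∧ᶜ atom (symAtom (pointTest (precompose queryBit (stepCode k S))) [])
  updateFormula k S (pointTest g) = atom (symAtom (pointTest (precompose g (stepCode k S))) [])

  module _ {n} {c : CQState σ schema (suc n)} {q : QFState σ ρ (suc n)} (sim : Simulates c q) where

    symAtom-holds : ∀ {m} s (env : Vec (Fin (suc n)) m) vs →
                    evalAtom c env (symAtom s vs) ≡ meaning q s (vmap (lookup env) vs)
    symAtom-holds s env vs = trans (auxDB≡meaning sim (encode s) _) (transport (decode-encode s))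
      where
      transport : ∀ {s'} (e : s' ≡ s) → meaning q s' (vmap (lookup env) (≡.subst (Vec (Fin _)) (cong arSym (≡.sym e)) vs))
                                          ≡ meaning q s (vmap (lookup env) vs)
      transport refl = refl

    compiled : ∀ {m} e (env : Vec (Fin (suc n)) m) y → holds c (y ∷ env) (compile e) ≡ ⌊ y ≟F evalᵉ q env e ⌋
    compiled = compile-correct c (interpret q) (λ g → symAtom-holds (graphOf g))

    updateFormula-correct : ∀ k S a s b →
      holds c (a ++ b) (updateFormula k S s) ≡ meaning (stepQF P q (mod k S a)) s b
    updateFormula-correct k S a (graphOf g) (v ∷ xs) = begin
      holds c (a ++ v ∷ xs) (renameᶜ (placeResult (arIn σ S) (arity g)) (compile (newValue k S g)))
        ≡⟨ holds-rename c (◂-reindexes (lookup-++ʳ a (v ∷ xs) zero)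
                             (⊕-reindexes (↑ˡ-reindexes a (v ∷ xs))
                                          (∘-reindexes (↑ʳ-reindexes a (v ∷ xs)) (↑ʳ-reindexes (v ∷ []) xs))))
                        (compile (newValue k S g)) ⟩
      holds c (v ∷ a ++ xs) (compile (newValue k S g))
        ≡⟨ compiled (newValue k S g) (a ++ xs) v ⟩
      ⌊ v ≟F evalᵉ q (a ++ xs) (newValue k S g) ⌋
        ≡⟨ cong (λ w → ⌊ v ≟F w ⌋) (newValue-correct q k S g a xs) ⟩
      ⌊ v ≟F interpret (stepQF P q (mod k S a)) g xs ⌋ ∎
    updateFormula-correct k S a query b = begin
      anyFin (λ v → holds c (v ∷ a ++ b) (compile ⌈ φ ⌉ᶠ) ∧ evalAtom c (v ∷ a ++ b) isTrue)
        ∧ evalAtom c (a ++ b) stateTest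
        ≡⟨ cong₂ _∧_ (anyFin-cong (λ v → cong₂ _∧_ (trans (compiled ⌈ φ ⌉ᶠ (a ++ b) v)
                                                          (cong (λ w → ⌊ v ≟F w ⌋) (⌈⌉ᶠ-correct q (a ++ b) φ)))
                                                   (symAtom-holds (graphOf (const true)) (v ∷ a ++ b) (zero ∷ []))))
                     (trans (symAtom-holds (pointTest _) (a ++ b) []) (pointTruth-step n q k S a queryBit)) ⟩
      anyFin (λ v → ⌊ v ≟F ⌜ evalF q (a ++ b) φ ⌝ ⌋ ∧ isOne {n} v) ∧ pointTruth n q' queryBit
        ≡⟨ cong (_∧ pointTruth n q' queryBit) (anyFin-onePoint _ isOne) ⟩
      isOne {n} ⌜ relA (qAuxDB q') Qs b ⌝ ∧ pointTruth n q' queryBit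
        ≡⟨ query-readout n q' b ⟩
      relA (qAuxDB q') Qs b ∎
      where
      φ : Formula σ ρ (arIn σ S + arRel ρ Qs)
      φ = updateRel P k S Qs
      q' : QFState σ ρ (suc n)
      q' = stepQF P q (mod k S a)
      isTrue : CQAtom σ schema (suc (arIn σ S + arRel ρ Qs))
      isTrue = symAtom (graphOf (const true)) (zero ∷ [])
      stateTest : CQAtom σ schema (arIn σ S + arRel ρ Qs)
      stateTest = symAtom (pointTest (precompose queryBit (stepCode k S))) []
    updateFormula-correct k S a (pointTest g) [] =
      trans (symAtom-holds (pointTest _) (a ++ []) []) (pointTruth-step n q k S a g)

  program : CQProgram σ
  program = record
    { auxSch = schema
    ; update = λ k S R → toCQ (updateFormula k S (decode R))
    ; init   = λ n I R → meaning (qst I (qfInit P n I)) (decode R)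
    ; qSym   = encode query
    }

  step-simulates : ∀ {n} {c : CQState σ schema (suc n)} {q} → Simulates c q → ∀ δ →
                   Simulates (stepCQ program c δ) (stepQF P q δ)
  step-simulates {c = c} sim (mod k S a) = simulates λ R b →
    trans (toCQ-correct c (a ++ b) (updateFormula k S (decode R))) (updateFormula-correct sim k S a (decode R) b)

  run-simulates : ∀ {n} (α : List (Mod σ (suc n))) {c q} → Simulates c q →
                  Simulates (runCQ program c α) (runQF P q α)
  run-simulates []      sim = sim
  run-simulates (δ ∷ α) sim = run-simulates α (step-simulates sim δ)

  program-maintains : ∀ {𝒬} → MaintainsQF P 𝒬 → MaintainsCQ program 𝒬
  program-maintains {𝒬} (arity≡ , maintains) = answer-arity (decode-encode query) , λ n I α b →
    trans (auxDB≡meaning (run-simulates α (simulates λ _ _ → refl)) (encode query) b)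
          (answer-query (decode-encode query) n I α b)
    where
    answer-arity : ∀ {s} → s ≡ query → arSym s ≡ qArity 𝒬
    answer-arity e = trans (cong arSym e) arity≡
    answer-query : ∀ {s} (e : s ≡ query) n I α (b : Vec (Fin (suc n)) (arSym s)) →
      meaning (runQF P (qst I (qfInit P n I)) α) s b ≡ answer 𝒬 n (applySeq α I) (cast (answer-arity e) b)
    answer-query refl = maintains

theorem3p12 : (σ : InSchema) (𝒬 : Query σ) → DynQF σ 𝒬 → DynCQ σ 𝒬
theorem3p12 σ 𝒬 (P , maintains) = program , program-maintains {𝒬} maintains
  where open Simulation P
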